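{- Let $G=(V,E)$ be a finite undirected graph and $T$ a rooted spanning tree of $G$ with root $r_T$. Let $S=\{x_1,\dots,x_k\}\subseteq V\setminus\{r_T\}$ be a set of $k\ge2$ distinct vertices. Then $\gamma(x_1^{\downarrow T},x_2^{\downarrow T},\dots,x_k^{\downarrow T})$ is determined by (can be computed from) the values $\gamma(x_i^{\downarrow T},x_j^{\downarrow T})$ for all $x_i,x_j\in S$ together with the ancestor–descendant relationship in $T$ between $x_i$ and $x_j$ for all $x_i,x_j\in S$.
   Context: $v^{\downarrow T}$ is the set of descendants of $v$ in $T$, including $v$. For $B\subseteq V$, $\delta(B)$ is the set of edges of $G$ with exactly one endpoint in $B$. For vertex sets $A_1,\dots,A_i\subseteq V$, $\gamma(A_1,\dots,A_i)=|\delta(A_1)\cap\cdots\cap\delta(A_i)|$. -}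

module Defs where

open import Data.Nat using (ℕ; zero; suc; _<ᵇ_)
open import Data.Bool using (Bool; true; false; _xor_; _∧_; _∨_; if_then_else_)
open import Data.Fin using (Fin; toℕ) renaming (_≟_ to _≟ᶠ_)
open import Data.Bool.ListAction using (any; all)
open import Data.List using (List; []; _∷_; allFin; upTo; map; length; filter; concatMap)
open import Data.Product using (_×_; _,_; ∃)
open import Function using (_∘_)
open import Relation.Binary.PropositionalEquality using (_≡_; _≢_)
open import Relation.Nullary.Decidable using (⌊_⌋)

record Graph (n : ℕ) : Set where
  field
    Adj   : Fin n → Fin n → Bool
    sym   : ∀ u v → Adj u v ≡ Adj v u
    irrefl : ∀ v → Adj v v ≡ false

iter : ∀ {A : Set} → (A → A) → ℕ → A → A
iter f zero x    = x
iter f (suc k) x = f (iter f k x)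

-- Every tree edge {v, parent v}
-- (v ≠ root) is an edge of G, and every vertex reaches the root by
-- following parents (so the parent edges form a spanning tree rooted at root).
record RootedSpanningTree {n : ℕ} (G : Graph n) : Set where
  field
    root       : Fin n
    parent     : Fin n → Fin n
    parent-root : parent root ≡ root
    parent-adj : ∀ v → v ≢ root → Graph.Adj G v (parent v) ≡ true
    reaches    : ∀ v → ∃ λ k → iter parent k v ≡ root

-- ancestor T v w : v is an ancestor of w in T (v = w allowed), i.e.
-- v = parent^k(w) for some k.  Since depths in a tree on n vertices are
-- < n, it suffices to search k ∈ {0, …, n}.
ancestor : ∀ {n} {G : Graph n} → RootedSpanningTree G → Fin n → Fin n → Bool
ancestor {n} T v w =
  any (λ k → ⌊ iter (RootedSpanningTree.parent T) k w ≟ᶠ v ⌋) (upTo (suc n))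

desc : ∀ {n} {G : Graph n} → RootedSpanningTree G → Fin n → (Fin n → Bool)
desc T v w = ancestor T v w

-- The edge set E of G: unordered pairs {u,v} listed once as (u,v) with u < v.
edges : ∀ {n} → Graph n → List (Fin n × Fin n)
edges {n} G =
  filter (λ e → isEdge e)
    (concatMap (λ u → map (λ v → (u , v)) (allFin n)) (allFin n))
  where
  open import Relation.Nullary using (Dec; yes; no)
  open import Data.Bool using (T?)
  isEdge : (e : Fin n × Fin n) → Dec _
  isEdge (u , v) = T? ((toℕ u <ᵇ toℕ v) ∧ Graph.Adj G u v)

inδ : ∀ {n} → (Fin n → Bool) → Fin n × Fin n → Bool
inδ B (u , v) = B u xor B v

γ : ∀ {n} → Graph n → List (Fin n → Bool) → ℕ
γ G As = length (filter (λ e → Data.Bool.T? (all (λ B → inδ B e) As)) (edges G))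
  where import Data.Bool

-- An edge uv lies in δ(a↓) iff a is an ancestor of exactly one of u, v, and the ancestors of a
-- vertex form a chain.  Hence whether a third subtree c↓ is crossed by every edge crossing both
-- a↓ and b↓ depends only on the ancestor relation among a, b, c.  If some edge crosses
-- all x_l↓, then taking the deepest x_i above u and the deepest x_j above v (or the top and
-- bottom of one chain, when all x_l lie above the same end) gives a pair forcing every x_l, so
-- γ(x_1↓, …, x_k↓) = γ(x_i↓, x_j↓); if no pair forces every x_l, no edge crosses them all and γ = 0.
module Submission where

open import Defs
open import Data.Nat using (ℕ; _≥_)
open import Data.Bool using (Bool)
open import Data.Fin using (Fin)
open import Data.List using (_∷_; []; map)
open import Data.Vec.Functional using (toList)
open import Data.Product using (Σ)
open import Function.Definitions using (Injective)
open import Relation.Binary.PropositionalEquality using (_≡_; _≢_)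

open import Data.Nat using (zero; suc; _+_; _∸_; _≤_; _<_; z≤n; s≤s)
open import Data.Nat.Properties
  using (n<1+n; <⇒≤; m∸n+n≡m; +-comm; +-monoʳ-<; ≤-total; m≤n⇒m<n∨m≡n; m≤n⇒∃[o]m+o≡n)
open import Data.Bool using (true; false; not; _∧_; _∨_; _xor_; T; T?)
open import Data.Bool.Properties using (T-∧; T-∨)
open import Data.Bool.ListAction using (all)
open import Data.Fin using (toℕ)
open import Data.Fin.Properties using (pigeonhole; toℕ<n; any?; all?)
open import Data.List using (List; length; filter; upTo)
open import Data.List.Properties using (filter-≐; filter-none)
open import Data.List.Relation.Unary.All as All using (All; universal)
open import Data.List.Relation.Unary.All.Properties using (all⁺; all⁻; map⁺; map⁻; tabulate⁺; tabulate⁻)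
open import Data.List.Relation.Unary.Any.Properties using (any⁺; any⁻)
open import Data.List.Membership.Propositional using (find; lose)
open import Data.List.Membership.Propositional.Properties using (∈-upTo⁺)
open import Data.Product using (_×_; _,_; ∃; ∃₂)
open import Data.Sum as Sum using (_⊎_; inj₁; inj₂; [_,_])
open import Data.Empty using (⊥-elim)
open import Data.Unit using (⊤; tt)
open import Function using (_∘_; id; _⇔_; mk⇔; Equivalence)
open import Relation.Binary.Core using (Rel)
open import Relation.Binary.Definitions using (Reflexive; Transitive; Total)
open import Relation.Binary.PropositionalEquality using (refl; sym; trans; cong; subst; module ≡-Reasoning)
open import Relation.Nullary using (Dec; yes; no; ¬_; contradiction)
open import Relation.Nullary.Decidable using (toWitness; fromWitness)
open import Relation.Unary using (Pred; Decidable)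

iter-+ : ∀ {A : Set} (f : A → A) m n x → iter f (m + n) x ≡ iter f m (iter f n x)
iter-+ f zero    n x = refl
iter-+ f (suc m) n x = cong f (iter-+ f m n x)

iter-≤ : ∀ {A : Set} (f : A → A) {m n} x → m ≤ n → ∃ λ d → iter f d (iter f m x) ≡ iter f n x
iter-≤ f {m} x m≤n with d , refl ← m≤n⇒∃[o]m+o≡n m≤n =
  d , trans (sym (iter-+ f d m x)) (cong (λ e → iter f e x) (+-comm d m))

module _ {n : ℕ} (f : Fin n → Fin n) (w : Fin n) where

  -- By pigeonhole two of the first n + 1 iterates coincide, after which the orbit repeats.
  iter-within : ∀ k → ∃ λ k′ → k′ ≤ n × iter f k′ w ≡ iter f k w
  iter-within with i , j , i<j , iterᵢ≡iterⱼ ← pigeonhole (n<1+n n) (λ i → iter f (toℕ i) w) = go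
    where
    t : ℕ
    t = suc n ∸ toℕ j

    t+j≡1+n : t + toℕ j ≡ suc n
    t+j≡1+n = m∸n+n≡m (<⇒≤ (toℕ<n j))

    wrap : iter f (t + toℕ i) w ≡ iter f (suc n) w
    wrap = begin
      iter f (t + toℕ i) w         ≡⟨ iter-+ f t (toℕ i) w ⟩
      iter f t (iter f (toℕ i) w)  ≡⟨ cong (iter f t) iterᵢ≡iterⱼ ⟩
      iter f t (iter f (toℕ j) w)  ≡⟨ sym (iter-+ f t (toℕ j) w) ⟩
      iter f (t + toℕ j) w         ≡⟨ cong (λ e → iter f e w) t+j≡1+n ⟩
      iter f (suc n) w             ∎
      where open ≡-Reasoning

    t+i≤n : t + toℕ i ≤ n
    t+i≤n with s≤s le ← subst (t + toℕ i <_) t+j≡1+n (+-monoʳ-< t i<j) = le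

    go : ∀ k → ∃ λ k′ → k′ ≤ n × iter f k′ w ≡ iter f k w
    go zero = 0 , z≤n , refl
    go (suc k) with k′ , k′≤n , eq ← go k with m≤n⇒m<n∨m≡n k′≤n
    ... | inj₁ k′<n = suc k′ , k′<n , cong f eq
    ... | inj₂ refl = t + toℕ i , t+i≤n , trans wrap (cong f eq)

module Ancestry {n : ℕ} {G : Graph n} (τ : RootedSpanningTree G) where
  open RootedSpanningTree τ using (parent)

  _⊑_ : Fin n → Fin n → Bool
  _⊑_ = ancestor τ

  ⊑⇒iterate : ∀ {v w} → T (v ⊑ w) → ∃ λ k → iter parent k w ≡ v
  ⊑⇒iterate v⊑w with k , _ , found ← find (any⁻ _ (upTo (suc n)) v⊑w) = k , toWitness found

  iterate⇒⊑ : ∀ {v w} k → iter parent k w ≡ v → T (v ⊑ w)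
  iterate⇒⊑ {w = w} k eq with k′ , k′≤n , eq′ ← iter-within parent w k =
    any⁺ _ (lose (∈-upTo⁺ (s≤s k′≤n)) (fromWitness (trans eq′ eq)))

  ⊑-refl : ∀ v → T (v ⊑ v)
  ⊑-refl v = iterate⇒⊑ 0 refl

  ⊑-trans : ∀ {u v w} → T (u ⊑ v) → T (v ⊑ w) → T (u ⊑ w)
  ⊑-trans {w = w} u⊑v v⊑w with k , refl ← ⊑⇒iterate u⊑v | l , refl ← ⊑⇒iterate v⊑w =
    iterate⇒⊑ (k + l) (iter-+ parent k l w)

  ⊑-chain : ∀ {u v w} → T (u ⊑ w) → T (v ⊑ w) → T (u ⊑ v) ⊎ T (v ⊑ u)
  ⊑-chain {w = w} u⊑w v⊑w with k , refl ← ⊑⇒iterate u⊑w | l , refl ← ⊑⇒iterate v⊑w with ≤-total k l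
  ... | inj₁ k≤l = let d , eq = iter-≤ parent w k≤l in inj₂ (iterate⇒⊑ d eq)
  ... | inj₂ l≤k = let d , eq = iter-≤ parent w l≤k in inj₁ (iterate⇒⊑ d eq)

xor-either : ∀ {x y} → T (x xor y) → T x ⊎ T y
xor-either {true}  _   = inj₁ tt
xor-either {false} T-y = inj₂ T-y

xor-not-both : ∀ {x y} → T x → T y → ¬ T (x xor y)
xor-not-both {true} {true} _ _ ()

xor-or-both : ∀ {x y} → T x ⊎ T y → T (x xor y) ⊎ (T x × T y)
xor-or-both {true}  {true}  _ = inj₂ (tt , tt)
xor-or-both {true}  {false} _ = inj₁ tt
xor-or-both {false} {true}  _ = inj₁ tt
xor-or-both {false} {false} (inj₁ ())
xor-or-both {false} {false} (inj₂ ())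

T-not-∨ : ∀ {x y} → T (not x ∨ y) ⇔ (T x → T y)
T-not-∨ {true}  = mk⇔ (λ T-y _ → T-y) (λ f → f tt)
T-not-∨ {false} = mk⇔ (λ _ ()) (λ _ → tt)

empty⊎greatest : ∀ {k p ℓ} {P : Pred (Fin k) p} (_≤_ : Rel (Fin k) ℓ) → Decidable P →
  Reflexive _≤_ → Transitive _≤_ → (∀ {i j} → P i → P j → i ≤ j ⊎ j ≤ i) →
  (∀ i → ¬ P i) ⊎ ∃ λ i → P i × (∀ j → P j → j ≤ i)
empty⊎greatest {zero} _ _ _ _ _ = inj₁ λ ()
empty⊎greatest {suc k} _≤_ P? refl′ trans′ total
  with empty⊎greatest (λ i j → Fin.suc i ≤ Fin.suc j) (P? ∘ Fin.suc) refl′ trans′ total | P? Fin.zero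
... | inj₁ none | no ¬P₀ = inj₁ λ { Fin.zero → ¬P₀ ; (Fin.suc i) → none i }
... | inj₁ none | yes P₀ =
  inj₂ (Fin.zero , P₀ , λ { Fin.zero _ → refl′ ; (Fin.suc j) Pj → ⊥-elim (none j Pj) })
... | inj₂ (i , Pi , max) | no ¬P₀ =
  inj₂ (Fin.suc i , Pi , λ { Fin.zero P₀ → ⊥-elim (¬P₀ P₀) ; (Fin.suc j) → max j })
... | inj₂ (i , Pi , max) | yes P₀ with total P₀ Pi
...   | inj₁ 0≤i = inj₂ (Fin.suc i , Pi , λ { Fin.zero _ → 0≤i ; (Fin.suc j) → max j })
...   | inj₂ i≤0 =
  inj₂ (Fin.zero , P₀ , λ { Fin.zero _ → refl′ ; (Fin.suc j) Pj → trans′ (max j Pj) i≤0 })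

greatest : ∀ {k ℓ} (_≤_ : Rel (Fin (suc k)) ℓ) → Reflexive _≤_ → Transitive _≤_ → Total _≤_ →
           ∃ λ i → ∀ j → j ≤ i
greatest _≤_ refl′ trans′ total
  with empty⊎greatest {P = λ _ → ⊤} _≤_ (λ _ → yes tt) refl′ trans′ (λ {i} {j} _ _ → total i j)
... | inj₁ none = ⊥-elim (none Fin.zero tt)
... | inj₂ (i , _ , max) = i , λ j → max j tt

forcedBy : ∀ {I : Set} → (I → I → Bool) → I → I → I → Bool
forcedBy _⊑_ a b c = (c ⊑ a ∧ (not (c ⊑ b) ∨ b ⊑ c)) ∨ (c ⊑ b ∧ (not (c ⊑ a) ∨ a ⊑ c))

Certificate : ∀ {k} → (Fin k → Fin k → Bool) → Set
Certificate M = ∃₂ λ i j → ∀ l → T (forcedBy M i j l)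

certificate? : ∀ {k} (M : Fin k → Fin k → Bool) → Dec (Certificate M)
certificate? M = any? λ i → any? λ j → all? λ l → T? (forcedBy M i j l)

γ-from-pairs : ∀ {k} → (Fin k → Fin k → ℕ) → (Fin k → Fin k → Bool) → ℕ
γ-from-pairs g M with certificate? M
... | yes (i , j , _) = g i j
... | no _            = 0

module Crossing {n : ℕ} (_⊑_ : Fin n → Fin n → Bool)
  (⊑-refl : ∀ a → T (a ⊑ a))
  (⊑-trans : ∀ {a b c} → T (a ⊑ b) → T (b ⊑ c) → T (a ⊑ c))
  (⊑-chain : ∀ {a b w} → T (a ⊑ w) → T (b ⊑ w) → T (a ⊑ b) ⊎ T (b ⊑ a)) where

  Crosses : Fin n → Fin n × Fin n → Set
  Crosses a e = T (inδ (a ⊑_) e)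

  crosses⇒⊑ : ∀ {a u v} → Crosses a (u , v) → T (a ⊑ u) ⊎ T (a ⊑ v)
  crosses⇒⊑ {a} {u} = xor-either {a ⊑ u}

  crosses-or-common : ∀ {a c u v} → T (c ⊑ a) → Crosses a (u , v) →
                      Crosses c (u , v) ⊎ (T (c ⊑ u) × T (c ⊑ v))
  crosses-or-common c⊑a a× = xor-or-both (Sum.map (⊑-trans c⊑a) (⊑-trans c⊑a) (crosses⇒⊑ a×))

  -- If c ⊑ a missed an edge crossed by a, then c is a common ancestor of its ends; as b ⊑ u or
  -- b ⊑ v, b is comparable with c, so b ⊑ c and b would be a common ancestor too.
  crosses-below : ∀ {a b c e} → T (c ⊑ a) → (T (c ⊑ b) → T (b ⊑ c)) →
                  Crosses a e → Crosses b e → Crosses c e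
  crosses-below {b = b} {c} {u , v} c⊑a c⊑b⇒b⊑c a× b× with crosses-or-common c⊑a a×
  ... | inj₁ c× = c×
  ... | inj₂ (c⊑u , c⊑v) = contradiction b× (xor-not-both (⊑-trans b⊑c c⊑u) (⊑-trans b⊑c c⊑v))
    where
    b⊑c : T (b ⊑ c)
    b⊑c with crosses⇒⊑ b×
    ... | inj₁ b⊑u = [ c⊑b⇒b⊑c , id ] (⊑-chain c⊑u b⊑u)
    ... | inj₂ b⊑v = [ c⊑b⇒b⊑c , id ] (⊑-chain c⊑v b⊑v)

  forcedBy-crosses : ∀ {a b c e} → T (forcedBy _⊑_ a b c) → Crosses a e → Crosses b e → Crosses c e
  forcedBy-crosses forced a× b× with Equivalence.to T-∨ forced
  ... | inj₁ below-a = let c⊑a , rest = Equivalence.to T-∧ below-a in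
                       crosses-below c⊑a (Equivalence.to T-not-∨ rest) a× b×
  ... | inj₂ below-b = let c⊑b , rest = Equivalence.to T-∧ below-b in
                       crosses-below c⊑b (Equivalence.to T-not-∨ rest) b× a×

  forcedBy-intro₁ : ∀ {a b c} → T (c ⊑ a) → (T (c ⊑ b) → T (b ⊑ c)) → T (forcedBy _⊑_ a b c)
  forcedBy-intro₁ c⊑a c⊑b⇒b⊑c =
    Equivalence.from T-∨ (inj₁ (Equivalence.from T-∧ (c⊑a , Equivalence.from T-not-∨ c⊑b⇒b⊑c)))

  forcedBy-intro₂ : ∀ {a b c} → T (c ⊑ b) → (T (c ⊑ a) → T (a ⊑ c)) → T (forcedBy _⊑_ a b c)
  forcedBy-intro₂ {a} {b} {c} c⊑b c⊑a⇒a⊑c =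
    Equivalence.from (T-∨ {x = c ⊑ a ∧ (not (c ⊑ b) ∨ b ⊑ c)})
      (inj₂ (Equivalence.from T-∧ (c⊑b , Equivalence.from T-not-∨ c⊑a⇒a⊑c)))

  module _ {k : ℕ} (x : Fin (suc k) → Fin n) where

    chain-certificate : ∀ {w} → (∀ l → T (x l ⊑ w)) → Certificate (λ i j → x i ⊑ x j)
    chain-certificate below-w =
      let top , on-top       = greatest (λ i j → T (x i ⊑ x j)) (⊑-refl _) ⊑-trans total
          bottom , on-bottom = greatest (λ i j → T (x j ⊑ x i)) (⊑-refl _) (λ p q → ⊑-trans q p)
                                        (λ i j → total j i)
      in top , bottom , λ l → forcedBy-intro₁ (on-top l) (λ _ → on-bottom l)
      where
      total : ∀ i j → T (x i ⊑ x j) ⊎ T (x j ⊑ x i)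
      total i j = ⊑-chain (below-w i) (below-w j)

    greatest-below : ∀ w → (∀ l → ¬ T (x l ⊑ w)) ⊎
                           ∃ λ i → T (x i ⊑ w) × (∀ l → T (x l ⊑ w) → T (x l ⊑ x i))
    greatest-below w =
      empty⊎greatest (λ i j → T (x i ⊑ x j)) (λ l → T? (x l ⊑ w)) (⊑-refl _) ⊑-trans ⊑-chain

    crosses-all⇒certificate : ∀ {u v} → (∀ l → Crosses (x l) (u , v)) →
                              Certificate (λ i j → x i ⊑ x j)
    crosses-all⇒certificate {u} {v} all× with greatest-below v
    ... | inj₁ none⊑v = chain-certificate {u} λ l → [ id , ⊥-elim ∘ none⊑v l ] (crosses⇒⊑ (all× l))
    ... | inj₂ (j , j⊑v , max⊑v) with greatest-below u
    ...   | inj₁ none⊑u = chain-certificate {v} λ l → [ ⊥-elim ∘ none⊑u l , id ] (crosses⇒⊑ (all× l))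
    ...   | inj₂ (i , i⊑u , max⊑u) = i , j , λ l → [ forced-u l , forced-v l ] (crosses⇒⊑ (all× l))
      where
      forced-u : ∀ l → T (x l ⊑ u) → T (forcedBy _⊑_ (x i) (x j) (x l))
      forced-u l l⊑u = forcedBy-intro₁ (max⊑u l l⊑u)
        λ l⊑j → ⊥-elim (xor-not-both l⊑u (⊑-trans l⊑j j⊑v) (all× l))
      forced-v : ∀ l → T (x l ⊑ v) → T (forcedBy _⊑_ (x i) (x j) (x l))
      forced-v l l⊑v = forcedBy-intro₂ (max⊑v l l⊑v)
        λ l⊑i → ⊥-elim (xor-not-both (⊑-trans l⊑i i⊑u) l⊑v (all× l))

T-all-map-toList : ∀ {A B : Set} {k} (p : B → Bool) (g : A → B) (x : Fin k → A) →
                   T (all p (map g (toList x))) ⇔ (∀ i → T (p (g (x i))))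
T-all-map-toList p g x = mk⇔ (tabulate⁻ ∘ map⁻ ∘ all⁺ p _) (all⁻ p ∘ map⁺ ∘ tabulate⁺)

inδ-all : ∀ {n} → List (Fin n → Bool) → Fin n × Fin n → Bool
inδ-all As e = all (λ B → inδ B e) As

module _ {k n : ℕ} (G : Graph n) (τ : RootedSpanningTree G) (x : Fin (suc k) → Fin n) where
  open Ancestry τ
  open Crossing _⊑_ ⊑-refl ⊑-trans ⊑-chain

  subtrees : List (Fin n → Bool)
  subtrees = map (desc τ) (toList x)

  inδ-all-subtrees : ∀ {e} → T (inδ-all subtrees e) ⇔ (∀ l → Crosses (x l) e)
  inδ-all-subtrees {e} = T-all-map-toList (λ B → inδ B e) (desc τ) x

  γ-forced-pair : ∀ {i j} → (∀ l → T (forcedBy _⊑_ (x i) (x j) (x l))) →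
                  γ G subtrees ≡ γ G (desc τ (x i) ∷ desc τ (x j) ∷ [])
  γ-forced-pair {i} {j} forced =
    cong length (filter-≐ (T? ∘ inδ-all subtrees) (T? ∘ inδ-all pair) (all⇒pair , pair⇒all)
                          (edges G))
    where
    pair : List (Fin n → Bool)
    pair = desc τ (x i) ∷ desc τ (x j) ∷ []
    all⇒pair : ∀ {e} → T (inδ-all subtrees e) → T (inδ-all pair e)
    all⇒pair {e} all× = let crosses = Equivalence.to inδ-all-subtrees all× in
      all⁻ (λ B → inδ B e) {pair} (crosses i All.∷ crosses j All.∷ All.[])
    pair⇒all : ∀ {e} → T (inδ-all pair e) → T (inδ-all subtrees e)
    pair⇒all {e} pair× with i× All.∷ j× All.∷ All.[] ← all⁺ (λ B → inδ B e) pair pair× =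
      Equivalence.from inδ-all-subtrees λ l → forcedBy-crosses {x i} {x j} {x l} {e} (forced l) i× j×

  γ-without-certificate : ¬ Certificate (λ i j → x i ⊑ x j) → γ G subtrees ≡ 0
  γ-without-certificate no-certificate =
    cong length (filter-none (T? ∘ inδ-all subtrees) (universal none-crosses-all (edges G)))
    where
    none-crosses-all : ∀ e → ¬ T (inδ-all subtrees e)
    none-crosses-all (u , v) all× =
      no-certificate (crosses-all⇒certificate x {u} {v} (Equivalence.to inδ-all-subtrees all×))

  γ-from-pairs-correct :
    γ G subtrees ≡ γ-from-pairs (λ i j → γ G (desc τ (x i) ∷ desc τ (x j) ∷ [])) (λ i j → x i ⊑ x j)
  γ-from-pairs-correct with certificate? (λ i j → x i ⊑ x j)
  ... | yes (i , j , forced) = γ-forced-pair forced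
  ... | no no-certificate    = γ-without-certificate no-certificate

lemma4p3 : (k : ℕ) → k ≥ 2 →
    Σ ((Fin k → Fin k → ℕ) → (Fin k → Fin k → Bool) → ℕ) λ F →
      ∀ {n : ℕ} (G : Graph n) (T : RootedSpanningTree G) (x : Fin k → Fin n) →
        Injective _≡_ _≡_ x →
        (∀ i → x i ≢ RootedSpanningTree.root T) →
        γ G (map (desc T) (toList x))
          ≡ F (λ i j → γ G (desc T (x i) ∷ desc T (x j) ∷ []))
              (λ i j → ancestor T (x i) (x j))
lemma4p3 (suc k) _ = γ-from-pairs , λ G τ x _ _ → γ-from-pairs-correct G τ x
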